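{- Let $k\geq 1$, $n\geq 1$, and let $u,v\in\Sigma_k^n$. Let $i=\operatorname{lso}(u,v)$ and $j=\operatorname{lso}(v,u)$. Then $i+j>n$ if and only if both of the following hold: (a) $n+1\leq i+j\leq \frac{4}{3}n$, and (b) there exist distinct words $x,y\in\Sigma_k^{i+j-n}$ and words $s,t\in\Sigma_k^*$ such that $u=xsytx$ and $v=ytxsy$, the pair $(x,y)$ is mutually unbordered, and both $xsy$ and $ytx$ are unbordered with $\operatorname{so}(u,v)=ytx$ and $\operatorname{so}(v,u)=xsy$.
   Context: $\Sigma_k=\{0,1,\ldots,k-1\}$, $\Sigma_k^m$ is the set of length-$m$ words over $\Sigma_k$, $\Sigma_k^*$ the set of all finite words. A border of a word $w$ is a non-empty word that is both a proper prefix and a proper suffix of $w$; $w$ is unbordered if it has no border. For a pair of words $(u,v)$: a right-border is a non-empty word that is a proper suffix of $u$ and a proper prefix of $v$; a left-border is a non-empty word that is a proper prefix of $u$ and a proper suffix of $v$. The pair $(u,v)$ is mutually unbordered if it has neither a right-border nor a left-border. $\operatorname{so}(u,v)$ is the shortest right-border of $(u,v)$ ($\epsilon$ if none), so $\operatorname{so}(v,u)$ is the shortest left-border of $(u,v)$; $\operatorname{lso}(u,v)=|\operatorname{so}(u,v)|$ (which is $0$ if there is no right-border), and $\operatorname{lso}(v,u)=|\operatorname{so}(v,u)|$. -}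

module Defs where

open import Data.Nat using (ℕ; _<ᵇ_)
open import Data.Fin using (Fin)
open import Data.Fin.Properties using () renaming (_≟_ to _≟ᶠ_)
open import Data.List using (List; []; _∷_; _++_; length; take; drop; reverse; tails)
open import Data.List.Properties using (≡-dec)
open import Data.Bool using (Bool; true; false; _∧_; if_then_else_)
open import Data.Product using (Σ; _×_)
open import Relation.Nullary using (¬_)
open import Relation.Nullary.Decidable using (⌊_⌋)
open import Relation.Binary.PropositionalEquality using (_≡_; _≢_)

Word : ℕ → Set
Word k = List (Fin k)

module _ {k : ℕ} where

  ProperPrefix : Word k → Word k → Set
  ProperPrefix p w = Σ (Word k) λ r → r ≢ [] × p ++ r ≡ w

  ProperSuffix : Word k → Word k → Set
  ProperSuffix s w = Σ (Word k) λ r → r ≢ [] × r ++ s ≡ w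

  Border : Word k → Word k → Set
  Border b w = b ≢ [] × ProperPrefix b w × ProperSuffix b w

  Unbordered : Word k → Set
  Unbordered w = ∀ b → ¬ Border b w

  RightBorder : Word k → Word k → Word k → Set
  RightBorder u v b = b ≢ [] × ProperSuffix b u × ProperPrefix b v

  LeftBorder : Word k → Word k → Word k → Set
  LeftBorder u v b = b ≢ [] × ProperPrefix b u × ProperSuffix b v

  MutuallyUnbordered : Word k → Word k → Set
  MutuallyUnbordered u v = (∀ b → ¬ RightBorder u v b) × (∀ b → ¬ LeftBorder u v b)

  properPrefixᵇ : Word k → Word k → Bool
  properPrefixᵇ w v = (length w <ᵇ length v) ∧ ⌊ ≡-dec _≟ᶠ_ (take (length w) v) w ⌋

  firstWith : (Word k → Bool) → List (Word k) → Word k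
  firstWith p [] = []
  firstWith p (w ∷ ws) = if p w then w else firstWith p ws

  -- non-empty proper suffixes of u, shortest first
  nonEmptyProperSuffixes : Word k → List (Word k)
  nonEmptyProperSuffixes u = drop 1 (reverse (drop 1 (tails u)))

  -- so(u,v): the shortest right-border of (u,v), or ε if there is none
  so : Word k → Word k → Word k
  so u v = firstWith (λ w → properPrefixᵇ w v) (nonEmptyProperSuffixes u)

  lso : Word k → Word k → ℕ
  lso u v = length (so u v)

-- Let a = so(u,v) and b = so(v,u).  A shortest right-border is unbordered, since a border of it
-- would be a shorter right-border.  When |a| + |b| > n the two borders overlap inside u and inside v:
-- u = r₁a = br₃ gives a = y r₃, b = r₁ y, and v = r₄b = ar₂ gives a = r₄ x, b = x r₂.  A right- or
-- left-border of (x,y) would be a border of a or of b, so (x,y) is mutually unbordered; this forces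
-- the two factorisations y r₃ = r₄ x of a and x r₂ = r₁ y of b to separate as a = y t x, b = x s y.
-- Comparing lengths, |u| = |v| gives |x| = |y| = |a| + |b| - n, and n = 3|x| + |s| + |t| ≥ 3|x|.
module Submission where

open import Defs
open import Data.Nat using (ℕ; suc; _+_; _*_; _∸_; _≤_; _<_; z≤n; s≤s; z<s)
open import Data.Nat.Properties
open import Data.Nat.Tactic.RingSolver using (solve-∀)
open import Data.Bool using (Bool; true; false; T)
open import Data.Bool.Properties using (T-∧)
open import Data.List using (List; []; _∷_; [_]; length; _++_; take; drop; reverse; tails)
open import Data.List.Properties
  using (∷-injective; length-++; ++-assoc; ++-identityʳ; ++-conicalˡ; ++-conicalʳ; unfold-reverse; take++drop≡id; length-drop)
open import Data.List.Membership.Propositional using (_∈_)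
open import Data.List.Membership.Propositional.Properties using (∈-++⁻; ∈-++⁺ʳ)
open import Data.List.Relation.Unary.Any using (here; there)
open import Data.Product using (Σ; ∃-syntax; _×_; _,_)
import Data.Product as Product
open import Data.Sum using (_⊎_; inj₁; inj₂)
import Data.Sum as Sum
open import Data.Empty using (⊥-elim)
open import Function using (id)
open import Function.Bundles using (_⇔_; mk⇔; Equivalence)
open import Relation.Binary.PropositionalEquality hiding ([_])
open import Relation.Nullary using (¬_)
open import Relation.Nullary.Decidable using (toWitness; fromWitness)

module _ {ℓ} {A : Set ℓ} where

  length≤length-++ : ∀ (r c : List A) → length c ≤ length (r ++ c)
  length≤length-++ r c = subst (length c ≤_) (sym (length-++ r)) (m≤n+m (length c) (length r))

  length<length-++ : ∀ (r c : List A) → r ≢ [] → length c < length (r ++ c)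
  length<length-++ []      c r≢[] = ⊥-elim (r≢[] refl)
  length<length-++ (_ ∷ r) c _    = s≤s (length≤length-++ r c)

  length<length-++ʳ : ∀ (w r : List A) → r ≢ [] → length w < length (w ++ r)
  length<length-++ʳ w []      r≢[] = ⊥-elim (r≢[] refl)
  length<length-++ʳ w (_ ∷ r) _    = subst (length w <_) (sym (length-++ w)) (m<m+n (length w) z<s)

  take-length-++ : ∀ (w r : List A) → take (length w) (w ++ r) ≡ w
  take-length-++ []      r = refl
  take-length-++ (x ∷ w) r = cong (x ∷_) (take-length-++ w r)

  split-++ : ∀ (p q p′ q′ : List A) → p ++ q ≡ p′ ++ q′ → length p′ ≤ length p →
             ∃[ m ] p ≡ p′ ++ m × q′ ≡ m ++ q
  split-++ p       q []       q′ eq _         = p , refl , sym eq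
  split-++ (x ∷ p) q (y ∷ p′) q′ eq (s≤s le) with refl , eq′ ← ∷-injective eq
    with m , refl , refl ← split-++ p q p′ q′ eq′ le = m , refl , refl

  overlap-++ : ∀ {p a b q : List A} → b ++ q ≡ p ++ a → length (p ++ a) < length a + length b →
               ∃[ m ] b ≡ p ++ m × a ≡ m ++ q
  overlap-++ {p} {a} {b} {q} eq long = split-++ b q p a eq (<⇒≤ |p|<|b|)
    where
    |p|<|b| : length p < length b
    |p|<|b| = +-cancelʳ-< (length a) (length p) (length b)
                (subst₂ _<_ (length-++ p) (+-comm (length a) (length b)) long)

  suffixes⁺ : List A → List (List A)
  suffixes⁺ []       = []
  suffixes⁺ (c ∷ cs) = suffixes⁺ cs ++ [ c ∷ cs ]

  reverse-tails : ∀ (xs : List A) → reverse (tails xs) ≡ [] ∷ suffixes⁺ xs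
  reverse-tails []       = refl
  reverse-tails (x ∷ xs) = trans (unfold-reverse (x ∷ xs) (tails xs)) (cong (_++ [ x ∷ xs ]) (reverse-tails xs))

  ∈-suffixes⁺ : ∀ {c} xs → c ∈ suffixes⁺ xs → c ≢ [] × ∃[ r ] r ++ c ≡ xs
  ∈-suffixes⁺ (x ∷ xs) c∈ with ∈-++⁻ (suffixes⁺ xs) c∈
  ... | inj₂ (here refl) = (λ ()) , [] , refl
  ... | inj₁ c∈′ with c≢[] , r , refl ← ∈-suffixes⁺ xs c∈′ = c≢[] , x ∷ r , refl

  suffixes⁺-self : ∀ {c : List A} → c ≢ [] → c ∈ suffixes⁺ c
  suffixes⁺-self {[]}     c≢[] = ⊥-elim (c≢[] refl)
  suffixes⁺-self {x ∷ xs} _    = ∈-++⁺ʳ (suffixes⁺ xs) (here refl)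

  suffixes⁺-++ : ∀ (r c : List A) → ∃[ rest ] suffixes⁺ (r ++ c) ≡ suffixes⁺ c ++ rest
  suffixes⁺-++ []      c = [] , sym (++-identityʳ (suffixes⁺ c))
  suffixes⁺-++ (x ∷ r) c with rest , eq ← suffixes⁺-++ r c =
    rest ++ [ x ∷ r ++ c ] , trans (cong (_++ [ x ∷ r ++ c ]) eq) (++-assoc (suffixes⁺ c) rest _)

equal-lengths : ∀ X Y S T → (X + S) + (Y + (T + X)) ≡ (Y + (T + X)) + (S + Y) → X ≡ Y
equal-lengths X Y S T eq = +-cancelˡ-≡ (S + T + X + Y) X Y (trans (lhs X Y S T) (trans eq (rhs X Y S T)))
  where
  lhs : ∀ X Y S T → (S + T + X + Y) + X ≡ (X + S) + (Y + (T + X))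
  lhs = solve-∀
  rhs : ∀ X Y S T → (Y + (T + X)) + (S + Y) ≡ (S + T + X + Y) + Y
  rhs = solve-∀

overlap-arithmetic : ∀ {n A B X Y S T : ℕ} → A ≡ Y + (T + X) → B ≡ (X + S) + Y →
                     (X + S) + A ≡ n → A + (S + Y) ≡ n → n < A + B →
                     0 < Y × X ≡ A + B ∸ n × Y ≡ A + B ∸ n × 3 * (A + B) ≤ 4 * n
overlap-arithmetic {X = X} {Y} {S} {T} refl refl refl |v| n<
  with refl ← equal-lengths X Y S T (sym |v|) = 0<X , sym X≡ , sym X≡ , 3*≤4*
  where
  n : ℕ
  n = (X + S) + (X + (T + X))
  A+B : ℕ
  A+B = (X + (T + X)) + ((X + S) + X)
  A+B≡n+X : ∀ X S T → (X + (T + X)) + ((X + S) + X) ≡ ((X + S) + (X + (T + X))) + X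
  A+B≡n+X = solve-∀
  X≡ : A+B ∸ n ≡ X
  X≡ = trans (cong (_∸ n) (A+B≡n+X X S T)) (m+n∸m≡n n X)
  0<X : 0 < X
  0<X = +-cancelˡ-< n 0 X (subst₂ _<_ (sym (+-identityʳ n)) (A+B≡n+X X S T) n<)
  4n≡3[A+B]+S+T : ∀ X S T → 3 * ((X + (T + X)) + ((X + S) + X)) + (S + T) ≡ 4 * ((X + S) + (X + (T + X)))
  4n≡3[A+B]+S+T = solve-∀
  3*≤4* : 3 * A+B ≤ 4 * n
  3*≤4* = subst (3 * A+B ≤_) (4n≡3[A+B]+S+T X S T) (m≤m+n (3 * A+B) (S + T))

module _ {k : ℕ} where

  rightBorder-shorter : ∀ {x y c : Word k} → RightBorder x y c → length c < length x
  rightBorder-shorter {c = c} (_ , (e , e≢[] , refl) , _) = length<length-++ e c e≢[]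

  rightBorder-lift : ∀ {x y u v c : Word k} → ∃[ p ] p ++ x ≡ u → ∃[ q ] y ++ q ≡ v →
                     RightBorder x y c → RightBorder u v c
  rightBorder-lift {c = c} (p , refl) (q , refl) (c≢[] , (e , e≢[] , refl) , (f , f≢[] , refl)) =
    c≢[] , (p ++ e , (λ pe≡[] → e≢[] (++-conicalʳ p e pe≡[])) , ++-assoc p e c)
         , (f ++ q , (λ fq≡[] → f≢[] (++-conicalˡ f q fq≡[])) , sym (++-assoc c f q))

  rightBorder⇒border : ∀ {w c : Word k} → RightBorder w w c → Border c w
  rightBorder⇒border (c≢[] , suf , pre) = c≢[] , pre , suf

  unbordered⇒noRightBorder : ∀ {w x y : Word k} → Unbordered w → ∃[ p ] p ++ x ≡ w → ∃[ q ] y ++ q ≡ w →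
                             ∀ c → ¬ RightBorder x y c
  unbordered⇒noRightBorder unb px qy c rb = unb c (rightBorder⇒border (rightBorder-lift px qy rb))

  unbordered⇒≢ : ∀ {x y t : Word k} → y ≢ [] → Unbordered (y ++ t ++ x) → x ≢ y
  unbordered⇒≢ {x} {t = t} x≢[] unb refl =
    unb x (x≢[] , (t ++ x , (λ tx≡[] → x≢[] (++-conicalʳ t x tx≡[])) , refl)
                , (x ++ t , (λ xt≡[] → x≢[] (++-conicalˡ x t xt≡[])) , ++-assoc x t x))

  -- If the factorisations crossed, y = q m and x = m p, the overlap m would be a right-border of (y,x).
  noRightBorder⇒split : ∀ {x y p q : Word k} → y ++ p ≡ q ++ x → p ≢ [] → q ≢ [] →
                        (∀ c → ¬ RightBorder y x c) → ∃[ t ] q ≡ y ++ t × p ≡ t ++ x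
  noRightBorder⇒split {x} {y} {p} {q} eq p≢[] q≢[] noRB with ≤-total (length y) (length q)
  ... | inj₁ |y|≤|q| = split-++ q x y p (sym eq) |y|≤|q|
  ... | inj₂ |q|≤|y| with split-++ y p q x eq |q|≤|y|
  ...   | []    , refl , refl = [] , sym (trans (++-identityʳ _) (++-identityʳ q)) , refl
  ...   | m@(_ ∷ _) , y≡qm , x≡mp = ⊥-elim (noRB m ((λ ()) , (q , q≢[] , sym y≡qm) , (p , p≢[] , sym x≡mp)))

  module _ (p : Word k → Bool) where

    firstWith-spec : ∀ l → firstWith p l ≡ [] ⊎ (firstWith p l ∈ l × T (p (firstWith p l)))
    firstWith-spec []      = inj₁ refl
    firstWith-spec (w ∷ l) with p w in pw
    ... | true  = inj₂ (here refl , subst T (sym pw) _)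
    ... | false = Sum.map id (Product.map₁ there) (firstWith-spec l)

    firstWith-∈ : ∀ {c l} → c ∈ l → T (p c) → firstWith p l ∈ l
    firstWith-∈ {l = w ∷ l} c∈ pc with p w in pw
    firstWith-∈ _          _  | true  = here refl
    firstWith-∈ (here refl) pc | false = ⊥-elim (subst T pw pc)
    firstWith-∈ (there c∈)  pc | false = there (firstWith-∈ c∈ pc)

    firstWith-++ : ∀ {c l} m → c ∈ l → T (p c) → firstWith p (l ++ m) ≡ firstWith p l
    firstWith-++ {l = w ∷ l} m c∈ pc with p w in pw
    firstWith-++ m _          _  | true  = refl
    firstWith-++ m (here refl) pc | false = ⊥-elim (subst T pw pc)
    firstWith-++ m (there c∈)  pc | false = firstWith-++ m c∈ pc

  properPrefixᵇ-sound : ∀ (w v : Word k) → T (properPrefixᵇ w v) → ProperPrefix w v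
  properPrefixᵇ-sound w v pp =
    drop (length w) v , rest≢[] , trans (cong (_++ drop (length w) v) (sym take≡w)) (take++drop≡id (length w) v)
    where
    open Equivalence T-∧ using (to)
    |w|<|v| : length w < length v
    |w|<|v| = <ᵇ⇒< (length w) (length v) (Product.proj₁ (to pp))
    take≡w : take (length w) v ≡ w
    take≡w = toWitness (Product.proj₂ (to pp))
    rest≢[] : drop (length w) v ≢ []
    rest≢[] rest≡[] = <⇒≢ (m<n⇒0<n∸m |w|<|v|) (sym (trans (sym (length-drop (length w) v)) (cong length rest≡[])))

  properPrefixᵇ-complete : ∀ {w v : Word k} → ProperPrefix w v → T (properPrefixᵇ w v)
  properPrefixᵇ-complete {w} (r , r≢[] , refl) =
    Equivalence.from T-∧ (<⇒<ᵇ |w|<|wr| , fromWitness (take-length-++ w r))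
    where
    |w|<|wr| : length w < length (w ++ r)
    |w|<|wr| = length<length-++ʳ w r r≢[]

  so-∷ : ∀ z zs (v : Word k) → so (z ∷ zs) v ≡ firstWith (λ w → properPrefixᵇ w v) (suffixes⁺ zs)
  so-∷ z zs v = cong (λ l → firstWith (λ w → properPrefixᵇ w v) (drop 1 l)) (reverse-tails zs)

  so-rightBorder : ∀ (u v : Word k) → so u v ≡ [] ⊎ RightBorder u v (so u v)
  so-rightBorder []       v = inj₁ refl
  so-rightBorder (z ∷ zs) v rewrite so-∷ z zs v with firstWith-spec (λ w → properPrefixᵇ w v) (suffixes⁺ zs)
  ... | inj₁ none      = inj₁ none
  ... | inj₂ (c∈ , pc) with c≢[] , r , r++c≡zs ← ∈-suffixes⁺ zs c∈ =
    inj₂ (c≢[] , (z ∷ r , (λ ()) , cong (z ∷_) r++c≡zs) , properPrefixᵇ-sound _ v pc)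

  firstWith-suffixes⁺-≤ : ∀ (p : Word k → Bool) {c} → c ≢ [] → T (p c) →
                          length (firstWith p (suffixes⁺ c)) ≤ length c
  firstWith-suffixes⁺-≤ p {c} c≢[] pc
    with r , r++first≡c ← Product.proj₂ (∈-suffixes⁺ c (firstWith-∈ p (suffixes⁺-self c≢[]) pc)) =
    subst (λ w → _ ≤ length w) r++first≡c (length≤length-++ r _)

  lso-minimal : ∀ {u v c : Word k} → RightBorder u v c → lso u v ≤ length c
  lso-minimal (_ , ([] , e≢[] , _) , _) = ⊥-elim (e≢[] refl)
  lso-minimal {v = v} {c} (c≢[] , (z ∷ r , _ , refl) , pre) with rest , eq ← suffixes⁺-++ r c = begin
      lso (z ∷ r ++ c) v                          ≡⟨ cong length (so-∷ z (r ++ c) v) ⟩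
      length (firstWith P (suffixes⁺ (r ++ c)))   ≡⟨ cong (λ l → length (firstWith P l)) eq ⟩
      length (firstWith P (suffixes⁺ c ++ rest))  ≡⟨ cong length (firstWith-++ P rest (suffixes⁺-self c≢[]) pc) ⟩
      length (firstWith P (suffixes⁺ c))          ≤⟨ firstWith-suffixes⁺-≤ P c≢[] pc ⟩
      length c                                    ∎
    where
    open ≤-Reasoning
    P : Word k → Bool
    P w = properPrefixᵇ w v
    pc : T (P c)
    pc = properPrefixᵇ-complete pre

  lso≤length : ∀ (u v : Word k) → lso u v ≤ length u
  lso≤length u v with so-rightBorder u v
  ... | inj₁ none = subst (λ w → length w ≤ length u) (sym none) z≤n
  ... | inj₂ rb   = <⇒≤ (rightBorder-shorter rb)

  so-unbordered : ∀ {u v : Word k} → RightBorder u v (so u v) → Unbordered (so u v)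
  so-unbordered {u} {v} (_ , (r₁ , _ , r₁a≡u) , (r₂ , _ , ar₂≡v)) c (c≢[] , pre , suf) =
    <⇒≱ (rightBorder-shorter rb) (lso-minimal (rightBorder-lift (r₁ , r₁a≡u) (r₂ , ar₂≡v) rb))
    where
    rb : RightBorder (so u v) (so u v) c
    rb = c≢[] , suf , pre

  so-isRightBorder : ∀ {n} (u v : Word k) → length v ≡ n → n < lso u v + lso v u → RightBorder u v (so u v)
  so-isRightBorder {n} u v |v| n< with so-rightBorder u v
  ... | inj₂ rb   = rb
  ... | inj₁ none = ⊥-elim (<⇒≱ n< (subst (λ w → length w + lso v u ≤ n) (sym none)
                                           (subst (lso v u ≤_) |v| (lso≤length v u))))

  overlap-lengths : ∀ {n} (x y s t : Word k) →
                    length ((x ++ s) ++ y ++ t ++ x) ≡ n → length ((y ++ t ++ x) ++ s ++ y) ≡ n →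
                    let |a|+|b| = length (y ++ t ++ x) + length ((x ++ s) ++ y) in n < |a|+|b| →
                    0 < length y × length x ≡ |a|+|b| ∸ n × length y ≡ |a|+|b| ∸ n × 3 * |a|+|b| ≤ 4 * n
  overlap-lengths x y s t |u| |v| = overlap-arithmetic
    (trans (length-++ y) (cong (length y +_) (length-++ t)))
    (trans (length-++ (x ++ s)) (cong (_+ length y) (length-++ x)))
    (trans (sym (trans (length-++ (x ++ s)) (cong (_+ _) (length-++ x)))) |u|)
    (trans (sym (trans (length-++ (y ++ t ++ x)) (cong (_ +_) (length-++ s)))) |v|)

  OverlappingBorders : ℕ → (u v a b : Word k) → Set
  OverlappingBorders n u v a b =
    (suc n ≤ length a + length b × 3 * (length a + length b) ≤ 4 * n)
    × Σ (Word k) λ x → Σ (Word k) λ y → Σ (Word k) λ s → Σ (Word k) λ t →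
        length x ≡ length a + length b ∸ n × length y ≡ length a + length b ∸ n × x ≢ y
        × u ≡ x ++ s ++ y ++ t ++ x × v ≡ y ++ t ++ x ++ s ++ y
        × MutuallyUnbordered x y
        × Unbordered (x ++ s ++ y) × Unbordered (y ++ t ++ x)
        × a ≡ y ++ t ++ x × b ≡ x ++ s ++ y

  overlapping-borders : ∀ {n} {u v a b : Word k} → length u ≡ n → length v ≡ n →
                        RightBorder u v a → RightBorder v u b → Unbordered a → Unbordered b →
                        n < length a + length b → OverlappingBorders n u v a b
  overlapping-borders {n} {a = a} {b} |u| |v| (_ , (r₁ , r₁≢[] , refl) , (r₂ , r₂≢[] , refl))
                      (_ , (r₄ , r₄≢[] , r₄b≡ar₂) , (r₃ , r₃≢[] , br₃≡r₁a)) ua ub n<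
    with y , refl , refl ← overlap-++ {p = r₁} {a} {b} {r₃} br₃≡r₁a (subst (_< length a + length b) (sym |u|) n<)
       | x , y++r₃≡r₄++x , r₁++y≡x++r₂ ← overlap-++ {p = r₄} {b} {a} {r₂} (sym r₄b≡ar₂)
           (subst₂ _<_ (sym (trans (cong length r₄b≡ar₂) |v|)) (+-comm (length a) (length b)) n<)
    with noRB-xy ← unbordered⇒noRightBorder ua (r₄ , sym y++r₃≡r₄++x) (r₃ , refl)
       | noRB-yx ← unbordered⇒noRightBorder ub (r₁ , refl) (r₂ , sym r₁++y≡x++r₂)
    with t , refl , refl ← noRightBorder⇒split y++r₃≡r₄++x r₃≢[] r₄≢[] noRB-yx
       | s , refl , refl ← noRightBorder⇒split (sym r₁++y≡x++r₂) r₂≢[] r₁≢[] noRB-xy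
    with 0<|y| , |x| , |y| , 3*≤4* ← overlap-lengths x y s t |u| |v| n< =
    (n< , 3*≤4*) , x , y , s , t , |x| , |y| , unbordered⇒≢ y≢[] ua
    , ++-assoc x s (y ++ t ++ x) , trans (++-assoc y (t ++ x) (s ++ y)) (cong (y ++_) (++-assoc t x (s ++ y)))
    , (noRB-xy , λ c (c≢[] , pre , suf) → noRB-yx c (c≢[] , suf , pre))
    , subst Unbordered (++-assoc x s y) ub , ua , refl , ++-assoc x s y
    where
    y≢[] : y ≢ []
    y≢[] y≡[] = <⇒≢ 0<|y| (sym (cong length y≡[]))

lemma5 : (k n : ℕ) → 1 ≤ k → 1 ≤ n → (u v : Word k) → length u ≡ n → length v ≡ n →
    (n < lso u v + lso v u)
    ⇔ ((suc n ≤ lso u v + lso v u × 3 * (lso u v + lso v u) ≤ 4 * n)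
       × Σ (Word k) λ x → Σ (Word k) λ y → Σ (Word k) λ s → Σ (Word k) λ t →
           length x ≡ lso u v + lso v u ∸ n × length y ≡ lso u v + lso v u ∸ n × x ≢ y
           × u ≡ x ++ s ++ y ++ t ++ x × v ≡ y ++ t ++ x ++ s ++ y
           × MutuallyUnbordered x y
           × Unbordered (x ++ s ++ y) × Unbordered (y ++ t ++ x)
           × so u v ≡ y ++ t ++ x × so v u ≡ x ++ s ++ y)
lemma5 k n _ _ u v |u| |v| = mk⇔ overlapping (λ shape → Product.proj₁ (Product.proj₁ shape))
  where
  overlapping : n < lso u v + lso v u → OverlappingBorders n u v (so u v) (so v u)
  overlapping n< = overlapping-borders |u| |v| rbᵤᵥ rbᵥᵤ (so-unbordered rbᵤᵥ) (so-unbordered rbᵥᵤ) n<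
    where
    rbᵤᵥ : RightBorder u v (so u v)
    rbᵤᵥ = so-isRightBorder u v |v| n<
    rbᵥᵤ : RightBorder v u (so v u)
    rbᵥᵤ = so-isRightBorder v u |u| (subst (n <_) (+-comm (lso u v) (lso v u)) n<)
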